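{- Let $\mathfrak{A}=\langle W,\{R_n\}_{n\ge 0},\|\cdot\|\rangle$ be a $\mathsf{J}^\ast$-model. Then $\mathfrak{A}$ is strongly persistent if and only if for all many-sorted formulas $\varphi$ and all $n\ge 0$: (1) if $|\varphi|\le n$, then $xR_ny$ and $y\Vdash\varphi$ imply $x\Vdash\varphi$; and (2) if $|\varphi|< n$, then $xR_ny$ and $y\nVdash\varphi$ imply $x\nVdash\varphi$.
   Context: Many-sorted polymodal formulas are built from propositional variables and $\top,\bot$ using $\neg,\land,\lor$ and unary modalities $\langle n\rangle$ for each $n<\omega$ (other Boolean connectives being abbreviations; $[n]\varphi:=\neg\langle n\rangle\neg\varphi$). Each propositional variable $p$ is assigned a unique sort $|p|\in\{0,1,2,\dots\}\cup\{\omega\}$. The sort $|\varphi|$ of a formula is defined by: $\top,\bot$ have sort $0$; $\varphi\land\psi$ and $\varphi\lor\psi$ have sort $\max\{|\varphi|,|\psi|\}$; $\neg\varphi$ has sort $|\varphi|+1$; $\langle n\rangle\varphi$ has sort $n$. A Kripke frame $\langle W,\{R_n\}_{n\ge0}\rangle$ is a $\mathsf{J}^\ast$-frame if: each $R_k$ is transitive and conversely well-founded (no infinite chain $x_0R_kx_1R_kx_2\cdots$); for $m<n$, $xR_ny$ implies ($xR_mz\iff yR_mz$ for all $z$); and for $m<n$, $xR_my$ and $yR_nz$ imply $xR_mz$. A $\mathsf{J}^\ast$-model is a $\mathsf{J}^\ast$-frame with a valuation $\|\cdot\|$ assigning to each variable a subset of $W$, extended to all formulas in the standard way ($x\Vdash\langle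 n\rangle\psi$ iff there is $y$ with $xR_ny$ and $y\Vdash\psi$). Such a model is strongly persistent if for every propositional variable $p$ and every $n$: if $|p|\le n$, $xR_ny$ and $y\Vdash p$, then $x\Vdash p$; and if $|p|<n$, $xR_ny$ and $y\nVdash p$, then $x\nVdash p$. -}

module Defs where

open import Data.Nat using (ℕ; zero; suc; _≤_; _<_; _⊔_)
open import Data.Product using (Σ; _×_; _,_; ∃)
open import Data.Sum using (_⊎_)
open import Data.Empty using (⊥)
open import Data.Unit using () renaming (⊤ to Unit)
open import Relation.Nullary using (¬_)
open import Level using (Level; _⊔_) renaming (suc to lsuc)

data Sort : Set where
  fin : ℕ → Sort
  ω   : Sort

data _≤ˢ_ : Sort → Sort → Set where
  fin≤fin : ∀ {m n} → m ≤ n → fin m ≤ˢ fin n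
  ≤ω      : ∀ {s} → s ≤ˢ ω

data _<ˢ_ : Sort → Sort → Set where
  fin<fin : ∀ {m n} → m < n → fin m <ˢ fin n
  fin<ω   : ∀ {m} → fin m <ˢ ω

maxˢ : Sort → Sort → Sort
maxˢ (fin m) (fin n) = fin (m Data.Nat.⊔ n)
maxˢ (fin m) ω = ω
maxˢ ω t = ω

sucˢ : Sort → Sort
sucˢ (fin m) = fin (suc m)
sucˢ ω = ω

data Form (Var : Set) : Set where
  var  : Var → Form Var
  ⊤'   : Form Var
  ⊥'   : Form Var
  ¬'_  : Form Var → Form Var
  _∧'_ : Form Var → Form Var → Form Var
  _∨'_ : Form Var → Form Var → Form Var
  ⟨_⟩_ : ℕ → Form Var → Form Var

sortOf : {Var : Set} → (Var → Sort) → Form Var → Sort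
sortOf σ (var p)   = σ p
sortOf σ ⊤'        = fin 0
sortOf σ ⊥'        = fin 0
sortOf σ (¬' φ)    = sucˢ (sortOf σ φ)
sortOf σ (φ ∧' ψ)  = maxˢ (sortOf σ φ) (sortOf σ ψ)
sortOf σ (φ ∨' ψ)  = maxˢ (sortOf σ φ) (sortOf σ ψ)
sortOf σ (⟨ n ⟩ φ) = fin n

record JFrame (ℓ ℓ' : Level) : Set (lsuc (ℓ Level.⊔ ℓ')) where
  field
    W : Set ℓ
    R : ℕ → W → W → Set ℓ'
    trans     : ∀ k {x y z} → R k x y → R k y z → R k x z
    convWF    : ∀ k → ¬ (Σ (ℕ → W) λ f → ∀ i → R k (f i) (f (suc i)))
    sameBelow : ∀ {m n} → m < n → ∀ {x y} → R n x y →
                ∀ z → (R m x z → R m y z) × (R m y z → R m x z)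
    mixTrans  : ∀ {m n} → m < n → ∀ {x y z} → R m x y → R n y z → R m x z

record JModel (Var : Set) (ℓ ℓ' ℓv : Level) : Set (lsuc (ℓ Level.⊔ ℓ' Level.⊔ ℓv)) where
  field
    frame : JFrame ℓ ℓ'
  open JFrame frame public
  field
    val : Var → W → Set ℓv

module _ {Var : Set} {ℓ ℓ' ℓv : Level} (𝔄 : JModel Var ℓ ℓ' ℓv) where
  open JModel 𝔄

  _⊩_ : W → Form Var → Set (ℓ Level.⊔ ℓ' Level.⊔ ℓv)
  x ⊩ var p     = Level.Lift (ℓ Level.⊔ ℓ') (val p x)
  x ⊩ ⊤'        = Level.Lift _ Unit
  x ⊩ ⊥'        = Level.Lift _ ⊥
  x ⊩ (¬' φ)    = ¬ (x ⊩ φ)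
  x ⊩ (φ ∧' ψ)  = (x ⊩ φ) × (x ⊩ ψ)
  x ⊩ (φ ∨' ψ)  = (x ⊩ φ) ⊎ (x ⊩ ψ)
  x ⊩ (⟨ n ⟩ φ) = Σ W λ y → R n x y × (y ⊩ φ)

  StronglyPersistent : (Var → Sort) → Set (ℓ Level.⊔ ℓ' Level.⊔ ℓv)
  StronglyPersistent σ =
    ∀ (p : Var) (n : ℕ) →
      (σ p ≤ˢ fin n → ∀ {x y} → R n x y → val p y → val p x) ×
      (σ p <ˢ fin n → ∀ {x y} → R n x y → ¬ val p y → ¬ val p x)

  FormulaPersistent : (Var → Sort) → Set (ℓ Level.⊔ ℓ' Level.⊔ ℓv)
  FormulaPersistent σ =
    ∀ (φ : Form Var) (n : ℕ) →
      (sortOf σ φ ≤ˢ fin n → ∀ {x y} → R n x y → y ⊩ φ → x ⊩ φ) ×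
      (sortOf σ φ <ˢ fin n → ∀ {x y} → R n x y → ¬ (y ⊩ φ) → ¬ (x ⊩ φ))

-- Strong persistence is the atomic case of formula persistence, and the converse is an induction on
-- formulas in which the two clauses feed each other through negation: ¬'φ persists upwards along
-- R n because φ persists downwards, and vice versa. Modal formulas ⟨m⟩φ need no induction
-- hypothesis at all: upward persistence along R n for m ≤ n is transitivity of R m (m = n) or the
-- fact that R n-related worlds have the same R m-successors (m < n), which also gives downward
-- persistence for m < n.
module Submission where

open import Defs
open import Level using (Level; lift; lower)
open import Data.Product using (_×_; _,_; proj₁; proj₂)
open import Data.Sum using (inj₁; inj₂)
open import Data.Nat using (ℕ; _≤_; _<_)
open import Data.Nat.Properties using (m≤n⇒m<n∨m≡n; ≤-trans; ≤-<-trans; <⇒≤; m≤m⊔n; m≤n⊔m)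
open import Relation.Binary.PropositionalEquality using (refl)
open import Relation.Nullary using (¬_)

sucˢ-≤ˢ⇒<ˢ : ∀ {s n} → sucˢ s ≤ˢ fin n → s <ˢ fin n
sucˢ-≤ˢ⇒<ˢ {fin m} (fin≤fin p) = fin<fin p

sucˢ-<ˢ⇒≤ˢ : ∀ {s n} → sucˢ s <ˢ fin n → s ≤ˢ fin n
sucˢ-<ˢ⇒≤ˢ {fin m} (fin<fin p) = fin≤fin (<⇒≤ (<⇒≤ p))

maxˢ-≤ˢ⇒≤ˢ : ∀ {s t n} → maxˢ s t ≤ˢ fin n → s ≤ˢ fin n × t ≤ˢ fin n
maxˢ-≤ˢ⇒≤ˢ {fin a} {fin b} (fin≤fin p) =
  fin≤fin (≤-trans (m≤m⊔n a b) p) , fin≤fin (≤-trans (m≤n⊔m a b) p)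

maxˢ-<ˢ⇒<ˢ : ∀ {s t n} → maxˢ s t <ˢ fin n → s <ˢ fin n × t <ˢ fin n
maxˢ-<ˢ⇒<ˢ {fin a} {fin b} (fin<fin p) =
  fin<fin (≤-<-trans (m≤m⊔n a b) p) , fin<fin (≤-<-trans (m≤n⊔m a b) p)

module _ {Var : Set} {ℓ ℓ' ℓv : Level} (𝔄 : JModel Var ℓ ℓ' ℓv) where
  open JModel 𝔄

  _⊨_ : W → Form Var → Set (ℓ Level.⊔ ℓ' Level.⊔ ℓv)
  _⊨_ = _⊩_ 𝔄

  PersistsUp PersistsDown : ℕ → Form Var → Set (ℓ Level.⊔ ℓ' Level.⊔ ℓv)
  PersistsUp   n φ = ∀ {x y} → R n x y → y ⊨ φ → x ⊨ φ
  PersistsDown n φ = ∀ {x y} → R n x y → ¬ y ⊨ φ → ¬ x ⊨ φ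

  ⊤-persistsUp : ∀ n → PersistsUp n ⊤'
  ⊤-persistsUp n _ _ = lift _

  ⊤-persistsDown : ∀ n → PersistsDown n ⊤'
  ⊤-persistsDown n _ y⊭⊤ _ = y⊭⊤ (lift _)

  ⊥-persistsUp : ∀ n → PersistsUp n ⊥'
  ⊥-persistsUp n _ (lift ())

  ⊥-persistsDown : ∀ n → PersistsDown n ⊥'
  ⊥-persistsDown n _ _ x⊨⊥ = lower x⊨⊥

  ¬-persistsUp : ∀ {n φ} → PersistsDown n φ → PersistsUp n (¬' φ)
  ¬-persistsUp φ↓ = φ↓

  ¬-persistsDown : ∀ {n φ} → PersistsUp n φ → PersistsDown n (¬' φ)
  ¬-persistsDown φ↑ xRy y⊭¬φ x⊨¬φ = y⊭¬φ (λ y⊨φ → x⊨¬φ (φ↑ xRy y⊨φ))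

  ∧-persistsUp : ∀ {n φ ψ} → PersistsUp n φ → PersistsUp n ψ → PersistsUp n (φ ∧' ψ)
  ∧-persistsUp φ↑ ψ↑ xRy (y⊨φ , y⊨ψ) = φ↑ xRy y⊨φ , ψ↑ xRy y⊨ψ

  ∧-persistsDown : ∀ {n φ ψ} → PersistsDown n φ → PersistsDown n ψ → PersistsDown n (φ ∧' ψ)
  ∧-persistsDown φ↓ ψ↓ xRy y⊭φ∧ψ (x⊨φ , x⊨ψ) =
    φ↓ xRy (λ y⊨φ → ψ↓ xRy (λ y⊨ψ → y⊭φ∧ψ (y⊨φ , y⊨ψ)) x⊨ψ) x⊨φ

  ∨-persistsUp : ∀ {n φ ψ} → PersistsUp n φ → PersistsUp n ψ → PersistsUp n (φ ∨' ψ)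
  ∨-persistsUp φ↑ ψ↑ xRy (inj₁ y⊨φ) = inj₁ (φ↑ xRy y⊨φ)
  ∨-persistsUp φ↑ ψ↑ xRy (inj₂ y⊨ψ) = inj₂ (ψ↑ xRy y⊨ψ)

  ∨-persistsDown : ∀ {n φ ψ} → PersistsDown n φ → PersistsDown n ψ → PersistsDown n (φ ∨' ψ)
  ∨-persistsDown φ↓ ψ↓ xRy y⊭φ∨ψ (inj₁ x⊨φ) = φ↓ xRy (λ y⊨φ → y⊭φ∨ψ (inj₁ y⊨φ)) x⊨φ
  ∨-persistsDown φ↓ ψ↓ xRy y⊭φ∨ψ (inj₂ x⊨ψ) = ψ↓ xRy (λ y⊨ψ → y⊭φ∨ψ (inj₂ y⊨ψ)) x⊨ψ

  ⟨⟩-persistsUp : ∀ {m n} φ → m ≤ n → PersistsUp n (⟨ m ⟩ φ)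
  ⟨⟩-persistsUp {m} φ m≤n xRy (z , yRz , z⊨φ) with m≤n⇒m<n∨m≡n m≤n
  ... | inj₁ m<n  = z , proj₂ (sameBelow m<n xRy z) yRz , z⊨φ
  ... | inj₂ refl = z , trans m xRy yRz , z⊨φ

  ⟨⟩-persistsDown : ∀ {m n} φ → m < n → PersistsDown n (⟨ m ⟩ φ)
  ⟨⟩-persistsDown φ m<n xRy y⊭◇φ (z , xRz , z⊨φ) =
    y⊭◇φ (z , proj₁ (sameBelow m<n xRy z) xRz , z⊨φ)

  stronglyPersistent⇒formulaPersistent : ∀ σ → StronglyPersistent 𝔄 σ → FormulaPersistent 𝔄 σ
  stronglyPersistent⇒formulaPersistent σ sp = persists
    where
    persists : FormulaPersistent 𝔄 σ
    persists (var p) n =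
        (λ p≤n xRy y⊨p → lift (proj₁ (sp p n) p≤n xRy (lower y⊨p)))
      , (λ p<n xRy y⊭p x⊨p → proj₂ (sp p n) p<n xRy (λ y∈p → y⊭p (lift y∈p)) (lower x⊨p))
    persists ⊤' n = (λ _ → ⊤-persistsUp n) , (λ _ → ⊤-persistsDown n)
    persists ⊥' n = (λ _ → ⊥-persistsUp n) , (λ _ → ⊥-persistsDown n)
    persists (¬' φ) n =
        (λ ¬φ≤n → ¬-persistsUp (proj₂ (persists φ n) (sucˢ-≤ˢ⇒<ˢ ¬φ≤n)))
      , (λ ¬φ<n → ¬-persistsDown (proj₁ (persists φ n) (sucˢ-<ˢ⇒≤ˢ ¬φ<n)))
    persists (φ ∧' ψ) n =
        (λ le → let φ≤n , ψ≤n = maxˢ-≤ˢ⇒≤ˢ le in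
                ∧-persistsUp (proj₁ (persists φ n) φ≤n) (proj₁ (persists ψ n) ψ≤n))
      , (λ lt → let φ<n , ψ<n = maxˢ-<ˢ⇒<ˢ lt in
                ∧-persistsDown (proj₂ (persists φ n) φ<n) (proj₂ (persists ψ n) ψ<n))
    persists (φ ∨' ψ) n =
        (λ le → let φ≤n , ψ≤n = maxˢ-≤ˢ⇒≤ˢ le in
                ∨-persistsUp (proj₁ (persists φ n) φ≤n) (proj₁ (persists ψ n) ψ≤n))
      , (λ lt → let φ<n , ψ<n = maxˢ-<ˢ⇒<ˢ lt in
                ∨-persistsDown (proj₂ (persists φ n) φ<n) (proj₂ (persists ψ n) ψ<n))
    persists (⟨ m ⟩ φ) n =
        (λ { (fin≤fin m≤n) → ⟨⟩-persistsUp φ m≤n })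
      , (λ { (fin<fin m<n) → ⟨⟩-persistsDown φ m<n })

  formulaPersistent⇒stronglyPersistent : ∀ σ → FormulaPersistent 𝔄 σ → StronglyPersistent 𝔄 σ
  formulaPersistent⇒stronglyPersistent σ fp p n =
      (λ p≤n xRy y∈p → lower (proj₁ (fp (var p) n) p≤n xRy (lift y∈p)))
    , (λ p<n xRy y∉p x∈p → proj₂ (fp (var p) n) p<n xRy (λ y⊨p → y∉p (lower y⊨p)) (lift x∈p))

mainTheorem1 : {Var : Set} {ℓ ℓ' ℓv : Level} (σ : Var → Sort) (𝔄 : JModel Var ℓ ℓ' ℓv) →
    (StronglyPersistent 𝔄 σ → FormulaPersistent 𝔄 σ) × (FormulaPersistent 𝔄 σ → StronglyPersistent 𝔄 σ)
mainTheorem1 σ 𝔄 =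
  stronglyPersistent⇒formulaPersistent 𝔄 σ , formulaPersistent⇒stronglyPersistent 𝔄 σ
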